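{- Let $m\ge 2$, $n\ge 3$, let $S_m$ be the star $K_{1,m}$ and $C_n$ the cycle on $n$ vertices, and let $\Delta$ be the maximum degree of $S_m\times C_n$. Then $\chi''_{\Sigma}(S_m\times C_n)=\Delta+2$.
   Context: All graphs are finite and simple. A proper total $k$-coloring of a graph $G$ assigns to every vertex and every edge a color from $\{1,\dots,k\}$ such that adjacent vertices receive different colors, edges sharing an endpoint receive different colors, and no edge receives the same color as either of its endpoints. For such a coloring $c$ and a vertex $v$, let $f(v)=c(v)+\sum_{e\ni v} c(e)$. The coloring distinguishes adjacent vertices by sums if $f(u)\neq f(v)$ for every edge $uv$. $\chi''_{\Sigma}(G)$ denotes the smallest $k$ such that $G$ has a proper total $k$-coloring distinguishing adjacent vertices by sums. The product $G_1\times G_2$ is the Cartesian product: vertex set $V(G_1)\times V(G_2)$, with $(u_1,u_2)$ adjacent to $(v_1,v_2)$ iff either $u_1=v_1$ and $u_2v_2\in E(G_2)$, or $u_1v_1\in E(G_1)$ and $u_2=v_2$. The star $S_m$ has a central vertex adjacent to $m$ leaves. -}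

module Defs where

open import Data.Nat using (ℕ; zero; suc; _+_; _*_; _≤_; _≡ᵇ_; _⊔_)
open import Data.Nat.DivMod using (_%_)
open import Data.Bool using (Bool; true; false; _∨_; _∧_; not; if_then_else_)
open import Data.Fin using (Fin; toℕ; remQuot)
open import Data.Fin.Properties using (_≟_)
open import Data.List using (List; map; filter; foldr; length)
open import Data.Nat.ListAction using (sum)
open import Data.Bool.Properties using (∨-comm)
open import Relation.Nullary using (yes; no)
open import Relation.Binary.PropositionalEquality using (refl; cong₂; sym)
open import Data.List.Base using (allFin)
open import Data.Product using (_×_; _,_; proj₁; proj₂)
open import Relation.Binary.PropositionalEquality using (_≡_; _≢_)
import Data.Empty
open import Relation.Nullary.Decidable using (⌊_⌋)

record Graph : Set where
  field
    order : ℕ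
    adj   : Fin order → Fin order → Bool
    adj-sym   : ∀ u v → adj u v ≡ adj v u
    adj-irrefl : ∀ v → adj v v ≡ false
open Graph public

neighbours : (G : Graph) → Fin (order G) → List (Fin (order G))
neighbours G v = filter (λ u → adj G v u Data.Bool.≟ true) (allFin (order G))

degree : (G : Graph) → Fin (order G) → ℕ
degree G v = length (neighbours G v)

maxDegree : (G : Graph) → ℕ
maxDegree G = foldr _⊔_ 0 (map (degree G) (allFin (order G)))

-- A total colouring: a colour for each vertex, and a colour for each ordered
-- pair of vertices (only meaningful, and required symmetric, on edges).
record TotalColouring (G : Graph) : Set where
  field
    vcol : Fin (order G) → ℕ
    ecol : Fin (order G) → Fin (order G) → ℕ
open TotalColouring public

weight : (G : Graph) → TotalColouring G → Fin (order G) → ℕ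
weight G c v = vcol c v + sum (map (ecol c v) (neighbours G v))

IsNSDTotalColouring : (G : Graph) → ℕ → TotalColouring G → Set
IsNSDTotalColouring G k c =
    (∀ v → 1 ≤ vcol c v × vcol c v ≤ k)
  × (∀ u v → adj G u v ≡ true → 1 ≤ ecol c u v × ecol c u v ≤ k)
  × (∀ u v → adj G u v ≡ true → ecol c u v ≡ ecol c v u)
  × (∀ u v → adj G u v ≡ true → vcol c u ≢ vcol c v)
  × (∀ u v w → adj G u v ≡ true → adj G u w ≡ true → v ≢ w → ecol c u v ≢ ecol c u w)
  × (∀ u v → adj G u v ≡ true → ecol c u v ≢ vcol c u)
  × (∀ u v → adj G u v ≡ true → weight G c u ≢ weight G c v)

HasNSDTotalColouring : Graph → ℕ → Set
HasNSDTotalColouring G k = Data.Product.Σ (TotalColouring G) (IsNSDTotalColouring G k)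

TotalSumChromaticNumberIs : Graph → ℕ → Set
TotalSumChromaticNumberIs G k =
  HasNSDTotalColouring G k × (∀ j → HasNSDTotalColouring G j → k ≤ j)

symClosure : {n : ℕ} → (Fin n → Fin n → Bool) → Fin n → Fin n → Bool
symClosure r u v = not ⌊ u ≟ v ⌋ ∧ (r u v ∨ r v u)

private
  neq-sym : {n : ℕ} (u v : Fin n) → not ⌊ u ≟ v ⌋ ≡ not ⌊ v ≟ u ⌋
  neq-sym u v with u ≟ v | v ≟ u
  ... | yes _ | yes _ = refl
  ... | no _ | no _ = refl
  ... | yes p | no q = Data.Empty.⊥-elim (q (sym p))
  ... | no p | yes q = Data.Empty.⊥-elim (p (sym q))

  neq-irr : {n : ℕ} (u : Fin n) → not ⌊ u ≟ u ⌋ ≡ false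
  neq-irr u with u ≟ u
  ... | yes _ = refl
  ... | no p = Data.Empty.⊥-elim (p refl)

mkGraph : (n : ℕ) → (Fin n → Fin n → Bool) → Graph
mkGraph n r = record
  { order = n
  ; adj = symClosure r
  ; adj-sym = λ u v → cong₂ _∧_ (neq-sym u v) (∨-comm (r u v) (r v u))
  ; adj-irrefl = λ v → cong₂ _∧_ (neq-irr v) refl
  }

starRel : (m : ℕ) → Fin (suc m) → Fin (suc m) → Bool
starRel m Fin.zero (Fin.suc _) = true
starRel m _ _ = false

Star : ℕ → Graph
Star m = mkGraph (suc m) (starRel m)

-- Cycle C_n on Fin n: i ~ j iff j ≡ i + 1 (mod n) (symmetrised); simple cycle for n ≥ 3.
cycleRel : (n : ℕ) → Fin n → Fin n → Bool
cycleRel zero () _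
cycleRel (suc n) i j = suc (toℕ i) % suc n ≡ᵇ toℕ j

Cycle : ℕ → Graph
Cycle n = mkGraph n (cycleRel n)

prodRel : (G₁ G₂ : Graph) → Fin (order G₁ * order G₂) → Fin (order G₁ * order G₂) → Bool
prodRel G₁ G₂ i j with remQuot {order G₁} (order G₂) i | remQuot {order G₁} (order G₂) j
... | (u₁ , u₂) | (v₁ , v₂) =
  (⌊ u₁ ≟ v₁ ⌋ ∧ adj G₂ u₂ v₂) ∨ (adj G₁ u₁ v₁ ∧ ⌊ u₂ ≟ v₂ ⌋)

_□_ : Graph → Graph → Graph
G₁ □ G₂ = mkGraph (order G₁ * order G₂) (prodRel G₁ G₂)

module Submission where

-- Δ = m + 2 is the degree of the copies of the centre of S_m, and consecutive copies along the
-- cycle are adjacent. At a vertex of degree Δ the vertex and its Δ incident edges carry distinct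
-- colours, so with Δ + 1 colours they use every colour once and the weight is 1 + ⋯ + (Δ + 1)
-- at both ends of such an edge; hence at least Δ + 2 colours are needed.
-- For Δ + 2 = m + 4 colours we give an explicit colouring. The spokes to all leaves but the first
-- get the pairwise distinct colours 6, …, m + 4, which makes every copy of the centre heavier
-- than its leaf neighbours. Everything else is read off small tables indexed by the phase of the
-- cycle position; the phases around C_n follow the word 0 1 0 1 … 3 2, which works for both
-- parities of n. Each remaining condition involves three consecutive phases only, and is decided
-- over the nine windows of three consecutive phases that occur.

open import Defs
open import Data.Nat using (ℕ; zero; suc; _+_; _≤_; _<_; _⊔_; _%_; z≤n; s≤s)
import Data.Nat as ℕ
open import Data.Nat.Properties
  using (≤-trans; ≤-reflexive; ≤-antisym; ≤∧≢⇒<; <⇒≢; ≤-pred; m≤n⇒m≤1+n; m≤n⇒m<n∨m≡n;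
         m<n⇒m<1+n; n<1+n; n≮n; 1+n≢n; suc-injective; ≡ᵇ⇒≡; ≡⇒≡ᵇ; m≤m⊔n; m≤n⊔m; ⊔-lub;
         m≤m+n; m≤n+m; +-comm; +-identityʳ; +-cancelˡ-≡; +-cancelʳ-≡; +-monoʳ-≤; +-mono-<-≤; <-≤-trans)
open import Data.Nat.DivMod using (m%n<n; m<n⇒m%n≡m; n%n≡0)
open import Data.Nat.Tactic.RingSolver using (solve-∀)
open import Data.Bool using (Bool; true; false; if_then_else_)
import Data.Bool as Bool
open import Data.Bool.Properties using (T-≡; T-∧; T-∨)
open import Data.Fin using (Fin; zero; suc; toℕ; fromℕ<; fromℕ; inject₁; combine; remQuot)
import Data.Fin.Properties as Fin
open import Data.Fin.Properties
  using (_≟_; toℕ-fromℕ<; toℕ-fromℕ; toℕ-inject₁; toℕ-injective; toℕ<n; toℕ≤pred[n];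
         remQuot-combine; combine-remQuot)
open import Data.List using (List; []; _∷_; _++_; length; map; tabulate; allFin)
open import Data.List.Properties
  using (foldr-preservesᵇ; foldr-preservesᵒ; length-map; length-tabulate; map-∘; map-cong; map-tabulate)
open import Data.Nat.ListAction using (sum)
open import Data.Nat.ListAction.Properties using (sum-↭)
open import Data.List.Relation.Unary.All as All using (All; []; _∷_; all?)
import Data.List.Relation.Unary.All.Properties as All
import Data.List.Relation.Unary.Any as Any
open import Data.List.Relation.Unary.Any using (here; there)
open import Data.List.Relation.Unary.Unique.Propositional using (Unique; []; _∷_)
import Data.List.Relation.Unary.Unique.Propositional.Properties as Unique
open import Data.List.Membership.Propositional using (_∈_; _∉_)
open import Data.List.Membership.Propositional.Properties
  using (∈-∃++; ∈-filter⁻; ∈-filter⁺; ∈-allFin; ∈-map⁺; ∈-map⁻; ∈-tabulate⁺; ∈-tabulate⁻)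
open import Data.List.Membership.Propositional.Properties.WithK using (unique∧set⇒bag)
open import Data.List.Relation.Binary.BagAndSetEquality using (∼bag⇒↭)
open import Data.List.Relation.Binary.Permutation.Propositional using (_↭_; ↭⇒↭ₛ)
open import Data.List.Relation.Binary.Permutation.Propositional.Properties
  using (shift; ↭-length; All-resp-↭)
import Data.List.Relation.Binary.Permutation.Propositional.Properties as Perm
open import Data.List.Relation.Binary.Permutation.Setoid.Properties using (Unique-resp-↭)
open import Data.Product using (_×_; _,_; proj₁; proj₂; ∃-syntax; uncurry)
open import Data.Product.Properties using (≡-dec)
open import Data.Sum using (_⊎_; [_,_]; inj₁; inj₂)
open import Data.Empty using (⊥-elim)
open import Function using (_∘_; _⇔_; mk⇔; Equivalence; case_of_)
open import Relation.Nullary using (Dec; yes; no; contradiction; ¬?; _×-dec_)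
open import Relation.Nullary.Decidable using (True; ⌊_⌋; toWitness; dec-true; dec-false; isYes≗does)
open import Relation.Binary.PropositionalEquality
  using (_≡_; _≢_; refl; sym; trans; cong; cong₂; subst; subst₂; setoid; ≢-sym; module ≡-Reasoning)

open import Data.List.Membership.DecPropositional (ℕ._≟_) using (_∈?_)
open import Data.List.Membership.DecPropositional (≡-dec ℕ._≟_ (≡-dec ℕ._≟_ ℕ._≟_))
  using () renaming (_∈?_ to _∈³?_)

-- Distinct colours from a range

InRange : ℕ → ℕ → Set
InRange k v = 1 ≤ v × v ≤ k

triangle : ℕ → ℕ
triangle zero    = 0
triangle (suc j) = suc j + triangle j

∈⇒↭∷ : ∀ {A : Set} {x : A} {xs} → x ∈ xs → ∃[ ys ] xs ↭ x ∷ ys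
∈⇒↭∷ x∈xs with as , bs , refl ← ∈-∃++ x∈xs = as ++ bs , shift _ as bs

Unique-map⁺-∈ : ∀ {A B : Set} (f : A → B) {xs} → Unique xs →
              (∀ {v w} → v ∈ xs → w ∈ xs → v ≢ w → f v ≢ f w) → Unique (map f xs)
Unique-map⁺-∈ f []         _   = []
Unique-map⁺-∈ f (x∉ ∷ xs!) inj =
  All.map⁺ (All.tabulate (λ w∈ → inj (here refl) (there w∈) (All.lookup x∉ w∈)))
  ∷ Unique-map⁺-∈ f xs! (λ v∈ w∈ → inj (there v∈) (there w∈))

inRange-narrow : ∀ {j xs} → suc j ∉ xs → All (InRange (suc j)) xs → All (InRange j) xs
inRange-narrow j∉ xs⊆ = All.tabulate λ {x} x∈ →
  let 1≤x , x≤1+j = All.lookup xs⊆ x∈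
  in 1≤x , ≤-pred (≤∧≢⇒< x≤1+j λ { refl → j∉ x∈ })

remove-top : ∀ {j xs} → Unique xs → All (InRange (suc j)) xs → suc j ∈ xs →
             ∃[ ys ] xs ↭ suc j ∷ ys × Unique ys × All (InRange j) ys
remove-top xs! xs⊆ j∈ with ys , xs↭ ← ∈⇒↭∷ j∈
  with j∉ ∷ ys! ← Unique-resp-↭ (setoid ℕ) (↭⇒↭ₛ xs↭) xs!
  with _ ∷ ys⊆ ← All-resp-↭ xs↭ xs⊆
  = ys , xs↭ , ys! , inRange-narrow (λ j∈ → All.lookup j∉ j∈ refl) ys⊆

inRange-0⇒[] : ∀ {xs} → All (InRange 0) xs → xs ≡ []
inRange-0⇒[] []                 = refl
inRange-0⇒[] ((1≤x , x≤0) ∷ _) with () ← ≤-trans 1≤x x≤0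

distinct-inRange-length : ∀ j {xs} → Unique xs → All (InRange j) xs → length xs ≤ j
distinct-inRange-length zero    _   xs⊆ rewrite inRange-0⇒[] xs⊆ = z≤n
distinct-inRange-length (suc j) {xs} xs! xs⊆ with suc j ∈? xs
... | no j∉  = m≤n⇒m≤1+n (distinct-inRange-length j xs! (inRange-narrow j∉ xs⊆))
... | yes j∈ with ys , xs↭ , ys! , ys⊆ ← remove-top xs! xs⊆ j∈
  rewrite ↭-length xs↭ = s≤s (distinct-inRange-length j ys! ys⊆)

distinct-inRange-sum : ∀ j {xs} → Unique xs → All (InRange j) xs → length xs ≡ j → sum xs ≡ triangle j
distinct-inRange-sum zero    _   xs⊆ _ rewrite inRange-0⇒[] xs⊆ = refl
distinct-inRange-sum (suc j) {xs} xs! xs⊆ |xs| with suc j ∈? xs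
... | no j∉ =
  contradiction (subst (_≤ j) |xs| (distinct-inRange-length j xs! (inRange-narrow j∉ xs⊆))) (n≮n j)
... | yes j∈ with ys , xs↭ , ys! , ys⊆ ← remove-top xs! xs⊆ j∈ =
  trans (sum-↭ xs↭) (cong (suc j +_)
    (distinct-inRange-sum j ys! ys⊆ (suc-injective (trans (sym (↭-length xs↭)) |xs|))))

regroup : ∀ a b c d e → a + (b + (c + (d + e))) ≡ a + b + c + d + e
regroup = solve-∀

tabulate-≤-sum : ∀ {n} (f : Fin n → ℕ) i → f i ≤ sum (tabulate f)
tabulate-≤-sum f zero    = m≤m+n (f zero) _
tabulate-≤-sum f (suc i) = ≤-trans (tabulate-≤-sum (f ∘ suc) i) (m≤n+m _ (f zero))

-- Neighbourhoods and the lower bound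

module _ (G : Graph) where

  ∈-neighbours⁻ : ∀ {u v} → v ∈ neighbours G u → adj G u v ≡ true
  ∈-neighbours⁻ {u} v∈ = proj₂ (∈-filter⁻ (λ w → adj G u w Bool.≟ true) {xs = allFin (order G)} v∈)

  ∈-neighbours⁺ : ∀ {u v} → adj G u v ≡ true → v ∈ neighbours G u
  ∈-neighbours⁺ {u} {v} uv = ∈-filter⁺ (λ w → adj G u w Bool.≟ true) (∈-allFin v) uv

  neighbours-unique : ∀ u → Unique (neighbours G u)
  neighbours-unique u = Unique.filter⁺ (λ w → adj G u w Bool.≟ true) (Unique.allFin⁺ (order G))

  neighbours-↭ : ∀ {u xs} → Unique xs → (∀ {v} → v ∈ xs ⇔ adj G u v ≡ true) → neighbours G u ↭ xs
  neighbours-↭ {u} xs! ∈xs⇔ = ∼bag⇒↭ (unique∧set⇒bag (neighbours-unique u) xs!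
    (mk⇔ (λ v∈ → Equivalence.from ∈xs⇔ (∈-neighbours⁻ v∈))
         (λ v∈ → ∈-neighbours⁺ (Equivalence.to ∈xs⇔ v∈))))

  degree≤maxDegree : ∀ v → degree G v ≤ maxDegree G
  degree≤maxDegree v = foldr-preservesᵒ
    (λ x y → [ (λ d≤x → ≤-trans d≤x (m≤m⊔n x y)) , (λ d≤y → ≤-trans d≤y (m≤n⊔m x y)) ])
    0 _ (inj₂ (Any.map ≤-reflexive (∈-map⁺ (degree G) (∈-allFin v))))

  maxDegree-lub : ∀ {d} → (∀ v → degree G v ≤ d) → maxDegree G ≤ d
  maxDegree-lub {d} deg≤ = foldr-preservesᵇ {P = _≤ d} {f = _⊔_} ⊔-lub z≤n
    (All.map⁺ {xs = allFin (order G)} (All.tabulate (λ {v} _ → deg≤ v)))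

-- weight G c u is, by definition, the sum of this list.
incidentColours : (G : Graph) → TotalColouring G → Fin (order G) → List ℕ
incidentColours G c u = vcol c u ∷ map (ecol c u) (neighbours G u)

module _ {G : Graph} {k : ℕ} {c : TotalColouring G} where

  incidentColours-unique : IsNSDTotalColouring G k c → ∀ u → Unique (incidentColours G c u)
  incidentColours-unique (_ , _ , _ , _ , ecol-proper , ecol≢vcol , _) u =
    All.map⁺ (All.tabulate λ v∈ e≡v → ecol≢vcol u _ (∈-neighbours⁻ G v∈) (sym e≡v))
    ∷ Unique-map⁺-∈ (ecol c u) (neighbours-unique G u)
        (λ v∈ w∈ → ecol-proper u _ _ (∈-neighbours⁻ G v∈) (∈-neighbours⁻ G w∈))

  incidentColours-inRange : IsNSDTotalColouring G k c → ∀ u → All (InRange k) (incidentColours G c u)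
  incidentColours-inRange (vcol-range , ecol-range , _) u =
    vcol-range u ∷ All.map⁺ (All.tabulate λ v∈ → ecol-range u _ (∈-neighbours⁻ G v∈))

  length-incidentColours : ∀ u → length (incidentColours G c u) ≡ suc (degree G u)
  length-incidentColours u = cong suc (length-map (ecol c u) (neighbours G u))

  1+degree≤colours : IsNSDTotalColouring G k c → ∀ u → suc (degree G u) ≤ k
  1+degree≤colours nsd u = subst (_≤ k) (length-incidentColours u)
    (distinct-inRange-length k (incidentColours-unique nsd u) (incidentColours-inRange nsd u))

  -- A vertex of degree k - 1 sees every colour 1, …, k exactly once.
  weight-saturated : IsNSDTotalColouring G k c → ∀ u → suc (degree G u) ≡ k → weight G c u ≡ triangle k
  weight-saturated nsd u full = distinct-inRange-sum k (incidentColours-unique nsd u)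
    (incidentColours-inRange nsd u) (trans (length-incidentColours u) full)

  2+degree≤colours : IsNSDTotalColouring G k c → ∀ {u v} → adj G u v ≡ true →
                     degree G u ≡ degree G v → suc (suc (degree G u)) ≤ k
  2+degree≤colours nsd@(_ , _ , _ , _ , _ , _ , weight-proper) {u} {v} uv du≡dv =
    ≤∧≢⇒< (1+degree≤colours nsd u) λ full → weight-proper u v uv
      (trans (weight-saturated nsd u full)
             (sym (weight-saturated nsd v (trans (cong suc (sym du≡dv)) full))))

module _ {n : ℕ} where

  ≟-diag : (x : Fin n) → ⌊ x ≟ x ⌋ ≡ true
  ≟-diag x = trans (isYes≗does (x ≟ x)) (dec-true (x ≟ x) refl)

  ≟-off-diag : {x y : Fin n} → x ≢ y → ⌊ x ≟ y ⌋ ≡ false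
  ≟-off-diag {x} {y} x≢y = trans (isYes≗does (x ≟ y)) (dec-false (x ≟ y) x≢y)

module _ {n : ℕ} (r : Fin n → Fin n → Bool) where

  symClosure⇒ : ∀ u v → symClosure r u v ≡ true → u ≢ v × (r u v ≡ true ⊎ r v u ≡ true)
  symClosure⇒ u v uv with u ≟ v | r u v | r v u
  ... | no u≢v | true  | _    = u≢v , inj₁ refl
  ... | no u≢v | false | true = u≢v , inj₂ refl

  symClosure⇐ : ∀ u v → u ≢ v → r u v ≡ true → symClosure r u v ≡ true
  symClosure⇐ u v u≢v ruv rewrite ≟-off-diag u≢v | ruv = refl

-- Phases and colour tables

-- phaseAt k lists the phases around C (k + 3): the word 0 1 0 1 … of length k + 1, followed by 3 2.
phaseAt : ℕ → ℕ → ℕ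
phaseAt _             0                         = 0
phaseAt 0             1                         = 3
phaseAt 0             2                         = 2
phaseAt 0             (suc (suc (suc _)))       = 0
phaseAt 1             1                         = 1
phaseAt 1             2                         = 3
phaseAt 1             3                         = 2
phaseAt 1             (suc (suc (suc (suc _)))) = 0
phaseAt (suc (suc k)) 1                         = 1
phaseAt (suc (suc k)) (suc (suc t))             = phaseAt k t

-- The triples (previous, current, next) of consecutive phases that occur.
windows : List (ℕ × ℕ × ℕ)
windows = (0 , 1 , 0) ∷ (1 , 0 , 1) ∷ (0 , 1 , 3) ∷ (1 , 0 , 3) ∷ (0 , 3 , 2)
        ∷ (1 , 3 , 2) ∷ (3 , 2 , 0) ∷ (2 , 0 , 1) ∷ (2 , 0 , 3) ∷ []

Window : ℕ → ℕ → ℕ → Set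
Window p c n = (p , c , n) ∈ windows

window! : ∀ {w} {_ : True (w ∈³? windows)} → w ∈ windows
window! {_} {w∈} = toWitness w∈

phaseAt-window : ∀ k t → t ≤ k → Window (phaseAt k t) (phaseAt k (suc t)) (phaseAt k (suc (suc t)))
phaseAt-window 0                         0             _               = window!
phaseAt-window 1                         0             _               = window!
phaseAt-window 1                         1             _               = window!
phaseAt-window 1                         (suc (suc _)) (s≤s ())
phaseAt-window (suc (suc k))             0             _               = window!
phaseAt-window 2                         1             _               = window!
phaseAt-window 3                         1             _               = window!
phaseAt-window (suc (suc (suc (suc k)))) 1             _               = window!
phaseAt-window (suc (suc k))             (suc (suc t)) (s≤s (s≤s t≤k)) = phaseAt-window k t t≤k

phaseAt-penultimate : ∀ k → phaseAt k (suc k) ≡ 3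
phaseAt-penultimate 0             = refl
phaseAt-penultimate 1             = refl
phaseAt-penultimate (suc (suc k)) = phaseAt-penultimate k

phaseAt-last : ∀ k → phaseAt k (suc (suc k)) ≡ 2
phaseAt-last 0             = refl
phaseAt-last 1             = refl
phaseAt-last (suc (suc k)) = phaseAt-last k

phaseAt-wrap : ∀ k → Window 2 0 (phaseAt k 1)
phaseAt-wrap 0             = window!
phaseAt-wrap 1             = window!
phaseAt-wrap (suc (suc k)) = window!

module _ (P : ℕ → ℕ → ℕ → Set) (P? : ∀ p c n → Dec (P p c n)) where

  private
    Holds : ℕ × ℕ × ℕ → Set
    Holds (p , c , n) = P p c n

    holds? : ∀ w → Dec (Holds w)
    holds? (p , c , n) = P? p c n

  onWindows : {_ : True (all? holds? windows)} → ∀ {p c n} → Window p c n → P p c n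
  onWindows {ok} = All.lookup (toWitness ok)

byPhase : ℕ → ℕ → ℕ → ℕ → ℕ → ℕ
byPhase v₀ _  _  _  0 = v₀
byPhase _  v₁ _  _  1 = v₁
byPhase _  _  v₂ _  2 = v₂
byPhase _  _  _  v₃ _ = v₃

-- The layers of S_m × C_n: the copy of C_n at the centre, at the first leaf, and at any other leaf.
data Layer : Set where
  hub firstLeaf leaf : Layer

vertexTable edgeTable : Layer → ℕ → ℕ
vertexTable hub       = byPhase 1 2 2 3
vertexTable firstLeaf = byPhase 2 3 1 4
vertexTable leaf      = byPhase 2 1 3 4
edgeTable   hub       = byPhase 4 5 5 1
edgeTable   firstLeaf = byPhase 6 5 5 3
edgeTable   leaf      = byPhase 3 5 5 1

firstSpoke : ℕ → ℕ
firstSpoke = byPhase 3 1 4 2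

-- At a vertex of layer L whose position has phase c and whose predecessor has phase p: its colour,
-- its two cycle edges and, if it has one, its first spoke.
ownWeight : Layer → ℕ → ℕ → ℕ
ownWeight L p c = vertexTable L c + edgeTable L c + edgeTable L p

phaseWeight : Layer → ℕ → ℕ → ℕ
phaseWeight hub       p c = ownWeight hub p c + firstSpoke c
phaseWeight firstLeaf p c = ownWeight firstLeaf p c + firstSpoke c
phaseWeight leaf      p c = ownWeight leaf p c

_≢?_ : (u v : ℕ) → Dec (u ≢ v)
u ≢? v = ¬? (u ℕ.≟ v)

inRange? : ∀ k v → Dec (InRange k v)
inRange? k v = (1 ℕ.≤? v) ×-dec (v ℕ.≤? k)

module _ {p c n : ℕ} where

  vertexTable-inRange : ∀ L → Window p c n → InRange 5 (vertexTable L c)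
  vertexTable-inRange hub       = onWindows _ λ _ c _ → inRange? 5 (vertexTable hub c)
  vertexTable-inRange firstLeaf = onWindows _ λ _ c _ → inRange? 5 (vertexTable firstLeaf c)
  vertexTable-inRange leaf      = onWindows _ λ _ c _ → inRange? 5 (vertexTable leaf c)

  edgeTable-inRange : ∀ L → Window p c n → InRange 6 (edgeTable L c)
  edgeTable-inRange hub       = onWindows _ λ _ c _ → inRange? 6 (edgeTable hub c)
  edgeTable-inRange firstLeaf = onWindows _ λ _ c _ → inRange? 6 (edgeTable firstLeaf c)
  edgeTable-inRange leaf      = onWindows _ λ _ c _ → inRange? 6 (edgeTable leaf c)

  edgeTable-small : ∀ L → L ≢ firstLeaf → Window p c n → edgeTable L c ≤ 5
  edgeTable-small hub       _ = onWindows _ λ _ c _ → edgeTable hub c ℕ.≤? 5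
  edgeTable-small firstLeaf L≢ = contradiction refl L≢
  edgeTable-small leaf      _ = onWindows _ λ _ c _ → edgeTable leaf c ℕ.≤? 5

  firstSpoke-inRange : Window p c n → InRange 5 (firstSpoke c)
  firstSpoke-inRange = onWindows _ λ _ c _ → inRange? 5 (firstSpoke c)

  vertexTable-proper : ∀ L → Window p c n → vertexTable L c ≢ vertexTable L n
  vertexTable-proper hub       = onWindows _ λ _ c n → vertexTable hub c ≢? vertexTable hub n
  vertexTable-proper firstLeaf = onWindows _ λ _ c n → vertexTable firstLeaf c ≢? vertexTable firstLeaf n
  vertexTable-proper leaf      = onWindows _ λ _ c n → vertexTable leaf c ≢? vertexTable leaf n

  hub≢vertexTable : ∀ L → L ≢ hub → Window p c n → vertexTable hub c ≢ vertexTable L c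
  hub≢vertexTable hub       L≢ = contradiction refl L≢
  hub≢vertexTable firstLeaf _  = onWindows _ λ _ c _ → vertexTable hub c ≢? vertexTable firstLeaf c
  hub≢vertexTable leaf      _  = onWindows _ λ _ c _ → vertexTable hub c ≢? vertexTable leaf c

  edgeTable-proper : ∀ L → Window p c n → edgeTable L c ≢ edgeTable L n
  edgeTable-proper hub       = onWindows _ λ _ c n → edgeTable hub c ≢? edgeTable hub n
  edgeTable-proper firstLeaf = onWindows _ λ _ c n → edgeTable firstLeaf c ≢? edgeTable firstLeaf n
  edgeTable-proper leaf      = onWindows _ λ _ c n → edgeTable leaf c ≢? edgeTable leaf n

  edgeTable≢vertexTable : ∀ L → Window p c n →
    edgeTable L c ≢ vertexTable L c × edgeTable L c ≢ vertexTable L n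
  edgeTable≢vertexTable hub       = onWindows _ λ _ c n →
    (edgeTable hub c ≢? vertexTable hub c) ×-dec (edgeTable hub c ≢? vertexTable hub n)
  edgeTable≢vertexTable firstLeaf = onWindows _ λ _ c n →
    (edgeTable firstLeaf c ≢? vertexTable firstLeaf c)
      ×-dec (edgeTable firstLeaf c ≢? vertexTable firstLeaf n)
  edgeTable≢vertexTable leaf      = onWindows _ λ _ c n →
    (edgeTable leaf c ≢? vertexTable leaf c) ×-dec (edgeTable leaf c ≢? vertexTable leaf n)

  firstSpoke≢vertexTable : ∀ L → L ≢ leaf → Window p c n → firstSpoke c ≢ vertexTable L c
  firstSpoke≢vertexTable hub       _  = onWindows _ λ _ c _ → firstSpoke c ≢? vertexTable hub c
  firstSpoke≢vertexTable firstLeaf _  = onWindows _ λ _ c _ → firstSpoke c ≢? vertexTable firstLeaf c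
  firstSpoke≢vertexTable leaf      L≢ = contradiction refl L≢

  edgeTable≢firstSpoke : ∀ L → L ≢ leaf → Window p c n →
    edgeTable L c ≢ firstSpoke c × edgeTable L c ≢ firstSpoke n
  edgeTable≢firstSpoke hub       _  = onWindows _ λ _ c n →
    (edgeTable hub c ≢? firstSpoke c) ×-dec (edgeTable hub c ≢? firstSpoke n)
  edgeTable≢firstSpoke firstLeaf _  = onWindows _ λ _ c n →
    (edgeTable firstLeaf c ≢? firstSpoke c) ×-dec (edgeTable firstLeaf c ≢? firstSpoke n)
  edgeTable≢firstSpoke leaf      L≢ = contradiction refl L≢

  phaseWeight-proper : ∀ L → Window p c n → phaseWeight L p c ≢ phaseWeight L c n
  phaseWeight-proper hub       = onWindows _ λ p c n → phaseWeight hub p c ≢? phaseWeight hub c n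
  phaseWeight-proper firstLeaf = onWindows _ λ p c n → phaseWeight firstLeaf p c ≢? phaseWeight firstLeaf c n
  phaseWeight-proper leaf      = onWindows _ λ p c n → phaseWeight leaf p c ≢? phaseWeight leaf c n

  phaseWeight-firstLeaf<hub+6 : Window p c n → phaseWeight firstLeaf p c < phaseWeight hub p c + 6
  phaseWeight-firstLeaf<hub+6 = onWindows _ λ p c _ → phaseWeight firstLeaf p c ℕ.<? phaseWeight hub p c + 6

  phaseWeight-leaf<hub : Window p c n → phaseWeight leaf p c < phaseWeight hub p c
  phaseWeight-leaf<hub = onWindows _ λ p c _ → phaseWeight leaf p c ℕ.<? phaseWeight hub p c

-- The cycle and the product

module CycleOf (k : ℕ) where

  N : ℕ
  N = suc (suc (suc k))

  next : Fin N → Fin N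
  next y = fromℕ< (m%n<n (suc (toℕ y)) N)

  prev : Fin N → Fin N
  prev zero    = fromℕ (suc (suc k))
  prev (suc i) = inject₁ i

  data Place (y : Fin N) : Set where
    inner       : toℕ y ≤ k           → Place y
    penultimate : toℕ y ≡ suc k       → Place y
    last        : toℕ y ≡ suc (suc k) → Place y

  place : ∀ y → Place y
  place y with m≤n⇒m<n∨m≡n (≤-pred (toℕ<n y))
  ... | inj₂ y≡ = last y≡
  ... | inj₁ y< with m≤n⇒m<n∨m≡n (≤-pred y<)
  ...   | inj₁ y<′ = inner (≤-pred y<′)
  ...   | inj₂ y≡  = penultimate y≡

  toℕ-next : ∀ y → toℕ (next y) ≡ suc (toℕ y) % N
  toℕ-next y = toℕ-fromℕ< (m%n<n (suc (toℕ y)) N)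

  toℕ-next-< : ∀ y → toℕ y ≤ suc k → toℕ (next y) ≡ suc (toℕ y)
  toℕ-next-< y y≤ = trans (toℕ-next y) (m<n⇒m%n≡m (s≤s (s≤s y≤)))

  toℕ-next-last : ∀ y → toℕ y ≡ suc (suc k) → toℕ (next y) ≡ 0
  toℕ-next-last y y≡ = trans (toℕ-next y) (subst (λ t → suc t % N ≡ 0) (sym y≡) (n%n≡0 N))

  toℕ-prev-0 : ∀ z → toℕ z ≡ 0 → toℕ (prev z) ≡ suc (suc k)
  toℕ-prev-0 zero _ = toℕ-fromℕ (suc (suc k))

  toℕ-prev-suc : ∀ z {t} → toℕ z ≡ suc t → toℕ (prev z) ≡ t
  toℕ-prev-suc (suc i) z≡ = trans (toℕ-inject₁ i) (suc-injective z≡)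

  next-prev : ∀ y → next (prev y) ≡ y
  next-prev zero    = toℕ-injective (toℕ-next-last (prev zero) (toℕ-prev-0 zero refl))
  next-prev (suc i) = toℕ-injective (trans (toℕ-next-< (prev (suc i)) i≤) (cong suc i≡))
    where
    i≡ : toℕ (prev (suc i)) ≡ toℕ i
    i≡ = toℕ-prev-suc (suc i) refl
    i≤ : toℕ (prev (suc i)) ≤ suc k
    i≤ = subst (_≤ suc k) (sym i≡) (≤-pred (toℕ<n i))

  prev-next : ∀ y → prev (next y) ≡ y
  prev-next y with place y
  ... | inner y≤       = toℕ-injective (toℕ-prev-suc (next y) (toℕ-next-< y (m≤n⇒m≤1+n y≤)))
  ... | penultimate y≡ = toℕ-injective (toℕ-prev-suc (next y) (toℕ-next-< y (≤-reflexive y≡)))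
  ... | last y≡        = toℕ-injective (trans (toℕ-prev-0 (next y) (toℕ-next-last y y≡)) (sym y≡))

  next-injective : ∀ {y y′} → next y ≡ next y′ → y ≡ y′
  next-injective {y} {y′} eq = trans (sym (prev-next y)) (trans (cong prev eq) (prev-next y′))

  toℕ-next²-inner : ∀ y → toℕ y ≤ k → toℕ (next (next y)) ≡ suc (suc (toℕ y))
  toℕ-next²-inner y y≤ = trans (toℕ-next-< (next y) (subst (_≤ suc k) (sym y+1) (s≤s y≤))) (cong suc y+1)
    where
    y+1 : toℕ (next y) ≡ suc (toℕ y)
    y+1 = toℕ-next-< y (m≤n⇒m≤1+n y≤)

  toℕ-next²-penultimate : ∀ y → toℕ y ≡ suc k → toℕ (next (next y)) ≡ 0
  toℕ-next²-penultimate y y≡ =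
    toℕ-next-last (next y) (trans (toℕ-next-< y (≤-reflexive y≡)) (cong suc y≡))

  toℕ-next²-last : ∀ y → toℕ y ≡ suc (suc k) → toℕ (next (next y)) ≡ 1
  toℕ-next²-last y y≡ = trans (toℕ-next-< (next y) (subst (_≤ suc k) (sym y+1) z≤n)) (cong suc y+1)
    where
    y+1 : toℕ (next y) ≡ 0
    y+1 = toℕ-next-last y y≡

  next≢id : ∀ y → next y ≢ y
  next≢id y eq with place y
  ... | inner y≤       = 1+n≢n (trans (sym (toℕ-next-< y (m≤n⇒m≤1+n y≤))) (cong toℕ eq))
  ... | penultimate y≡ = 1+n≢n (trans (sym (toℕ-next-< y (≤-reflexive y≡))) (cong toℕ eq))
  ... | last y≡ with () ← trans (sym (toℕ-next-last y y≡)) (trans (cong toℕ eq) y≡)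

  next²≢id : ∀ y → next (next y) ≢ y
  next²≢id y eq with place y
  ... | inner y≤ =
    <⇒≢ (m<n⇒m<1+n (n<1+n (toℕ y))) (sym (trans (sym (toℕ-next²-inner y y≤)) (cong toℕ eq)))
  ... | penultimate y≡ with () ← trans (sym (toℕ-next²-penultimate y y≡)) (trans (cong toℕ eq) y≡)
  ... | last y≡ with () ← trans (sym (toℕ-next²-last y y≡)) (trans (cong toℕ eq) y≡)

  prev≢next : ∀ y → prev y ≢ next y
  prev≢next y eq = next²≢id y (sym (trans (sym (next-prev y)) (cong next eq)))

  cycleRel⇒ : ∀ y y′ → cycleRel N y y′ ≡ true → y′ ≡ next y
  cycleRel⇒ y y′ r = toℕ-injective (trans (sym (≡ᵇ⇒≡ _ _ (Equivalence.from T-≡ r))) (sym (toℕ-next y)))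

  cycleRel-next : ∀ y → cycleRel N y (next y) ≡ true
  cycleRel-next y = Equivalence.to T-≡ (≡⇒≡ᵇ _ _ (sym (toℕ-next y)))

  adj-cycle⇒ : ∀ {y y′} → adj (Cycle N) y y′ ≡ true → y′ ≡ next y ⊎ y ≡ next y′
  adj-cycle⇒ {y} {y′} yy′ with symClosure⇒ (cycleRel N) y y′ yy′
  ... | _ , inj₁ r = inj₁ (cycleRel⇒ y y′ r)
  ... | _ , inj₂ r = inj₂ (cycleRel⇒ y′ y r)

  adj-cycle-next : ∀ y → adj (Cycle N) y (next y) ≡ true
  adj-cycle-next y = symClosure⇐ (cycleRel N) y (next y) (≢-sym (next≢id y)) (cycleRel-next y)


  phase : Fin N → ℕ
  phase y = phaseAt k (toℕ y)

  window-at : ∀ y {t u v} → toℕ y ≡ t → toℕ (next y) ≡ u → toℕ (next (next y)) ≡ v →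
              Window (phaseAt k t) (phaseAt k u) (phaseAt k v) →
              Window (phase y) (phase (next y)) (phase (next (next y)))
  window-at _ refl refl refl w = w

  window-ahead : ∀ y → Window (phase y) (phase (next y)) (phase (next (next y)))
  window-ahead y with place y
  ... | inner y≤ = window-at y refl (toℕ-next-< y (m≤n⇒m≤1+n y≤)) (toℕ-next²-inner y y≤)
                     (phaseAt-window k (toℕ y) y≤)
  ... | penultimate y≡ = window-at y y≡ (trans (toℕ-next-< y (≤-reflexive y≡)) (cong suc y≡))
                           (toℕ-next²-penultimate y y≡)
                           (subst₂ (λ a b → Window a b 0) (sym (phaseAt-penultimate k)) (sym (phaseAt-last k))
                                   window!)
  ... | last y≡ = window-at y y≡ (toℕ-next-last y y≡) (toℕ-next²-last y y≡)
                    (subst (λ a → Window a 0 (phaseAt k 1)) (sym (phaseAt-last k)) (phaseAt-wrap k))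

  window : ∀ y → Window (phase (prev y)) (phase y) (phase (next y))
  window y = subst (λ z → Window (phase (prev y)) (phase z) (phase (next z))) (next-prev y)
                   (window-ahead (prev y))

module StarCycle (a k : ℕ) where

  open CycleOf k public

  m : ℕ
  m = suc (suc a)

  G : Graph
  G = Star m □ Cycle N

  -- A vertex (x , y) of G lies over vertex x of S_m (the centre is zero) and vertex y of C_N.
  Vertex : Set
  Vertex = Fin (suc m) × Fin N

  pos : Fin (order G) → Vertex
  pos = remQuot N

  vertex : Vertex → Fin (order G)
  vertex = uncurry combine

  pos-vertex : ∀ p → pos (vertex p) ≡ p
  pos-vertex (x , y) = remQuot-combine x y

  vertex-pos : ∀ i → vertex (pos i) ≡ i
  vertex-pos = combine-remQuot {suc m} N

  pos-injective : ∀ {i j} → pos i ≡ pos j → i ≡ j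
  pos-injective {i} {j} eq = trans (sym (vertex-pos i)) (trans (cong vertex eq) (vertex-pos j))

  data Adjacent : Vertex → Vertex → Set where
    cycle-next : ∀ {x y}       → Adjacent (x , y) (x , next y)
    cycle-prev : ∀ {x y y′}    → y ≡ next y′ → Adjacent (x , y) (x , y′)
    hub-leaf   : ∀ {y} l → Adjacent (zero , y) (suc l , y)
    leaf-hub   : ∀ {y} l → Adjacent (suc l , y) (zero , y)

  Adjacent-sym : ∀ {p q} → Adjacent p q → Adjacent q p
  Adjacent-sym cycle-next        = cycle-prev refl
  Adjacent-sym (cycle-prev refl) = cycle-next
  Adjacent-sym (hub-leaf l)      = leaf-hub l
  Adjacent-sym (leaf-hub l)      = hub-leaf l

  Adjacent⇒≢ : ∀ {p q} → Adjacent p q → p ≢ q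
  Adjacent⇒≢ (cycle-next {y = y}) eq        = next≢id y (sym (cong proj₂ eq))
  Adjacent⇒≢ (cycle-prev {y′ = y′} refl) eq = next≢id y′ (cong proj₂ eq)

  vertexRel : Vertex → Vertex → Bool
  vertexRel (x , y) (x′ , y′) =
    (⌊ x ≟ x′ ⌋ Bool.∧ adj (Cycle N) y y′) Bool.∨ (adj (Star m) x x′ Bool.∧ ⌊ y ≟ y′ ⌋)

  prodRel-pos : ∀ i j → prodRel (Star m) (Cycle N) i j ≡ vertexRel (pos i) (pos j)
  prodRel-pos i j with remQuot {suc m} N i | remQuot {suc m} N j
  ... | _ | _ = refl

  cycle-adjacent : ∀ {x y y′} → y′ ≡ next y ⊎ y ≡ next y′ → Adjacent (x , y) (x , y′)
  cycle-adjacent (inj₁ refl) = cycle-next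
  cycle-adjacent (inj₂ y≡)   = cycle-prev y≡

  star-adjacent : ∀ {x x′ y} → adj (Star m) x x′ ≡ true → Adjacent (x , y) (x′ , y)
  star-adjacent {x} {x′} xx′ = from-starRel x x′ (proj₂ (symClosure⇒ (starRel m) x x′ xx′))
    where
    from-starRel : ∀ {y} x x′ → starRel m x x′ ≡ true ⊎ starRel m x′ x ≡ true → Adjacent (x , y) (x′ , y)
    from-starRel zero    (suc l) _         = hub-leaf l
    from-starRel (suc l) zero    _         = leaf-hub l
    from-starRel zero    zero    (inj₁ ())
    from-starRel zero    zero    (inj₂ ())
    from-starRel (suc _) (suc _) (inj₁ ())
    from-starRel (suc _) (suc _) (inj₂ ())

  vertexRel⇒Adjacent : ∀ p q → vertexRel p q ≡ true → Adjacent p q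
  vertexRel⇒Adjacent (x , y) (x′ , y′) r
    with Equivalence.to (T-∨ {⌊ x ≟ x′ ⌋ Bool.∧ adj (Cycle N) y y′}) (Equivalence.from T-≡ r)
  ... | inj₁ t with x≡ , yy′ ← Equivalence.to (T-∧ {⌊ x ≟ x′ ⌋}) t with refl ← toWitness x≡ =
    cycle-adjacent (adj-cycle⇒ (Equivalence.to T-≡ yy′))
  ... | inj₂ t with xx′ , y≡ ← Equivalence.to (T-∧ {adj (Star m) x x′}) t with refl ← toWitness y≡ =
    star-adjacent (Equivalence.to T-≡ xx′)

  Adjacent⇒vertexRel : ∀ {p q} → Adjacent p q → vertexRel p q ≡ true
  Adjacent⇒vertexRel (cycle-next {x} {y}) rewrite ≟-diag x | adj-cycle-next y = refl
  Adjacent⇒vertexRel (cycle-prev {x} {y′ = y′} refl)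
    rewrite ≟-diag x | adj-sym (Cycle N) (next y′) y′ | adj-cycle-next y′ = refl
  Adjacent⇒vertexRel (hub-leaf {y} l) rewrite ≟-diag y = refl
  Adjacent⇒vertexRel (leaf-hub {y} l) rewrite ≟-diag y = refl

  adj⇒Adjacent : ∀ i j → adj G i j ≡ true → Adjacent (pos i) (pos j)
  adj⇒Adjacent i j ij with symClosure⇒ (prodRel (Star m) (Cycle N)) i j ij
  ... | _ , inj₁ r = vertexRel⇒Adjacent (pos i) (pos j) (trans (sym (prodRel-pos i j)) r)
  ... | _ , inj₂ r = Adjacent-sym (vertexRel⇒Adjacent (pos j) (pos i) (trans (sym (prodRel-pos j i)) r))

  Adjacent⇒adj : ∀ i j → Adjacent (pos i) (pos j) → adj G i j ≡ true
  Adjacent⇒adj i j e = symClosure⇐ (prodRel (Star m) (Cycle N)) i j (Adjacent⇒≢ e ∘ cong pos)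
    (trans (prodRel-pos i j) (Adjacent⇒vertexRel e))

  spokes : Vertex → List Vertex
  spokes (zero  , y) = tabulate λ l → suc l , y
  spokes (suc _ , y) = (zero , y) ∷ []

  around : Vertex → List Vertex
  around (x , y) = (x , next y) ∷ (x , prev y) ∷ spokes (x , y)

  ∈-around⁻ : ∀ {p q} → q ∈ around p → Adjacent p q
  ∈-around⁻ {x , y} (here refl)                = cycle-next
  ∈-around⁻ {x , y} (there (here refl))        = cycle-prev (sym (next-prev y))
  ∈-around⁻ {zero , y} (there (there q∈))
    with l , refl ← ∈-tabulate⁻ {f = λ l → suc l , y} q∈ = hub-leaf l
  ∈-around⁻ {suc l , y} (there (there (here refl))) = leaf-hub l

  ∈-around⁺ : ∀ {p q} → Adjacent p q → q ∈ around p
  ∈-around⁺ cycle-next                          = here refl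
  ∈-around⁺ (cycle-prev {x} {y′ = y′} refl)     = there (here (cong (x ,_) (sym (prev-next y′))))
  ∈-around⁺ (hub-leaf {y} l)                    = there (there (∈-tabulate⁺ {f = λ l → suc l , y} l))
  ∈-around⁺ (leaf-hub l)                        = there (there (here refl))

  spokes-other-layer : ∀ x y y′ → All ((x , y′) ≢_) (spokes (x , y))
  spokes-other-layer zero    y y′ = All.tabulate⁺ {f = λ l → suc l , y} λ _ ()
  spokes-other-layer (suc _) y y′ = (λ ()) ∷ []

  around-unique : ∀ p → Unique (around p)
  around-unique (x , y) =
    ((λ eq → prev≢next y (sym (cong proj₂ eq))) ∷ spokes-other-layer x y (next y))
    ∷ spokes-other-layer x y (prev y)
    ∷ spokes-unique x
    where
    spokes-unique : ∀ x → Unique (spokes (x , y))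
    spokes-unique zero    = Unique.tabulate⁺ {f = λ l → suc l , y} (Fin.suc-injective ∘ cong proj₁)
    spokes-unique (suc _) = [] ∷ []

  neighbours-around : ∀ i → neighbours G i ↭ map vertex (around (pos i))
  neighbours-around i = neighbours-↭ G {u = i} (Unique.map⁺ vertex-injective (around-unique (pos i))) ∈⇔adj
    where
    vertex-injective : ∀ {p q} → vertex p ≡ vertex q → p ≡ q
    vertex-injective {p} {q} eq = trans (sym (pos-vertex p)) (trans (cong pos eq) (pos-vertex q))

    ∈⇔adj : ∀ {j} → j ∈ map vertex (around (pos i)) ⇔ adj G i j ≡ true
    ∈⇔adj {j} = mk⇔
      (λ j∈ → case ∈-map⁻ vertex j∈ of λ { (q , q∈ , refl) →
        Adjacent⇒adj i (vertex q) (subst (Adjacent (pos i)) (sym (pos-vertex q)) (∈-around⁻ q∈)) })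
      (λ ij → subst (_∈ map vertex (around (pos i))) (vertex-pos j)
        (∈-map⁺ vertex (∈-around⁺ (adj⇒Adjacent i j ij))))

  degree-around : ∀ i → degree G i ≡ length (around (pos i))
  degree-around i = trans (↭-length (neighbours-around i)) (length-map vertex (around (pos i)))

  Δ : ℕ
  Δ = 2 + m

  length-around≤Δ : ∀ p → length (around p) ≤ Δ
  length-around≤Δ (zero  , y) = ≤-reflexive (cong (2 +_) (length-tabulate (λ l → suc l , y)))
  length-around≤Δ (suc _ , y) = s≤s (s≤s (s≤s z≤n))

  hub-degree : ∀ y → degree G (vertex (zero , y)) ≡ Δ
  hub-degree y = trans (degree-around (vertex (zero , y)))
    (trans (cong (length ∘ around) (pos-vertex (zero , y))) (cong (2 +_) (length-tabulate (λ l → suc l , y))))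

  maxDegree≡Δ : maxDegree G ≡ Δ
  maxDegree≡Δ = ≤-antisym
    (maxDegree-lub G λ i → subst (_≤ Δ) (sym (degree-around i)) (length-around≤Δ (pos i)))
    (subst (_≤ maxDegree G) (hub-degree zero) (degree≤maxDegree G (vertex (zero , zero))))

  hub-edge : adj G (vertex (zero , zero)) (vertex (zero , next zero)) ≡ true
  hub-edge = Adjacent⇒adj (vertex (zero , zero)) (vertex (zero , next zero))
    (subst₂ Adjacent (sym (pos-vertex (zero , zero))) (sym (pos-vertex (zero , next zero))) cycle-next)

  colours-lower-bound : ∀ j → HasNSDTotalColouring G j → suc (suc Δ) ≤ j
  colours-lower-bound j (c , nsd) = subst (λ d → suc (suc d) ≤ j) (hub-degree zero)
    (2+degree≤colours {c = c} nsd {vertex (zero , zero)} {vertex (zero , next zero)} hub-edge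
      (trans (hub-degree zero) (sym (hub-degree (next zero)))))

  layerOf : Fin (suc m) → Layer
  layerOf zero          = hub
  layerOf (suc zero)    = firstLeaf
  layerOf (suc (suc _)) = leaf

  -- Leaves 2, …, m get the spoke colours 6, …, m + 4; the tables stay within 1, …, 5 except at the first leaf.
  spokeColour : Fin m → Fin N → ℕ
  spokeColour zero    y = firstSpoke (phase y)
  spokeColour (suc j) _ = 6 + toℕ j

  vertexColour : Vertex → ℕ
  vertexColour (x , y) = vertexTable (layerOf x) (phase y)

  -- A cycle edge is coloured by the phase of its tail, the endpoint whose successor is the other one.
  cycleEdgeColour : Fin (suc m) → Fin N → Fin N → ℕ
  cycleEdgeColour x y y′ = edgeTable (layerOf x) (phase (if ⌊ y′ ≟ next y ⌋ then y else y′))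

  edgeColour : Vertex → Vertex → ℕ
  edgeColour (zero  , y) (suc l , _)  = spokeColour l y
  edgeColour (suc l , y) (zero  , _)  = spokeColour l y
  edgeColour (x     , y) (_     , y′) = cycleEdgeColour x y y′

  colouring : TotalColouring G
  colouring = record { vcol = vertexColour ∘ pos ; ecol = λ i j → edgeColour (pos i) (pos j) }

  colourOf : ∀ {p q} → Adjacent p q → ℕ
  colourOf (cycle-next {x} {y})         = edgeTable (layerOf x) (phase y)
  colourOf (cycle-prev {x} {y′ = y′} _) = edgeTable (layerOf x) (phase y′)
  colourOf (hub-leaf {y} l)             = spokeColour l y
  colourOf (leaf-hub {y} l)             = spokeColour l y

  colourOf-sym : ∀ {p q} (e : Adjacent p q) → colourOf (Adjacent-sym e) ≡ colourOf e
  colourOf-sym cycle-next        = refl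
  colourOf-sym (cycle-prev refl) = refl
  colourOf-sym (hub-leaf _)      = refl
  colourOf-sym (leaf-hub _)      = refl

  edgeColour-layer : ∀ x y y′ → edgeColour (x , y) (x , y′) ≡ cycleEdgeColour x y y′
  edgeColour-layer zero    _ _ = refl
  edgeColour-layer (suc _) _ _ = refl

  cycleEdgeColour-forward : ∀ x y → cycleEdgeColour x y (next y) ≡ edgeTable (layerOf x) (phase y)
  cycleEdgeColour-forward x y rewrite ≟-diag (next y) = refl

  cycleEdgeColour-backward : ∀ x y y′ → y ≡ next y′ →
                             cycleEdgeColour x y y′ ≡ edgeTable (layerOf x) (phase y′)
  cycleEdgeColour-backward x _ y′ refl rewrite ≟-off-diag (≢-sym (next²≢id y′)) = refl

  edgeColour-Adjacent : ∀ {p q} (e : Adjacent p q) → edgeColour p q ≡ colourOf e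
  edgeColour-Adjacent (cycle-next {x} {y}) =
    trans (edgeColour-layer x y (next y)) (cycleEdgeColour-forward x y)
  edgeColour-Adjacent (cycle-prev {x} {y} {y′} y≡) =
    trans (edgeColour-layer x y y′) (cycleEdgeColour-backward x y y′ y≡)
  edgeColour-Adjacent (hub-leaf _) = refl
  edgeColour-Adjacent (leaf-hub _) = refl

  bigSpokes : ℕ
  bigSpokes = sum (tabulate {n = suc a} λ j → 6 + toℕ j)

  fixedWeight : Fin (suc m) → ℕ
  fixedWeight zero          = bigSpokes
  fixedWeight (suc zero)    = 0
  fixedWeight (suc (suc j)) = 6 + toℕ j

  localWeight : Vertex → ℕ
  localWeight p = vertexColour p + sum (map (edgeColour p) (around p))

  localWeight-cycle : ∀ x y → localWeight (x , y) ≡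
    vertexColour (x , y) + (edgeTable (layerOf x) (phase y) + (edgeTable (layerOf x) (phase (prev y))
      + sum (map (edgeColour (x , y)) (spokes (x , y)))))
  localWeight-cycle x y = cong (vertexColour (x , y) +_) (cong₂ _+_
    (trans (edgeColour-layer x y (next y)) (cycleEdgeColour-forward x y))
    (cong (_+ sum (map (edgeColour (x , y)) (spokes (x , y))))
      (trans (edgeColour-layer x y (prev y)) (cycleEdgeColour-backward x y (prev y) (sym (next-prev y))))))

  sum-spokes-hub : ∀ y →
    sum (map (edgeColour (zero , y)) (spokes (zero , y))) ≡ firstSpoke (phase y) + bigSpokes
  sum-spokes-hub y = cong sum (map-tabulate (λ l → suc l , y) (edgeColour (zero , y)))

  regroupAt : ∀ L y d e →
    vertexTable L (phase y) + (edgeTable L (phase y) + (edgeTable L (phase (prev y)) + (d + e)))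
      ≡ ownWeight L (phase (prev y)) (phase y) + d + e
  regroupAt L y = regroup (vertexTable L (phase y)) (edgeTable L (phase y)) (edgeTable L (phase (prev y)))

  localWeight-split : ∀ x y →
    localWeight (x , y) ≡ phaseWeight (layerOf x) (phase (prev y)) (phase y) + fixedWeight x
  localWeight-split zero y = trans (localWeight-cycle zero y) (trans
    (cong (λ s → vertexTable hub (phase y) + (edgeTable hub (phase y) + (edgeTable hub (phase (prev y)) + s)))
          (sum-spokes-hub y))
    (regroupAt hub y _ _))
  localWeight-split (suc zero) y = trans (localWeight-cycle (suc zero) y) (regroupAt firstLeaf y _ _)
  localWeight-split (suc (suc j)) y = trans (localWeight-cycle (suc (suc j)) y)
    (trans (regroupAt leaf y _ _) (+-identityʳ _))

  weight-colouring : ∀ i → weight G colouring i ≡ localWeight (pos i)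
  weight-colouring i = cong (vertexColour (pos i) +_) (begin
    sum (map (edgeColour p ∘ pos) (neighbours G i))
      ≡⟨ sum-↭ (Perm.map⁺ (edgeColour p ∘ pos) (neighbours-around i)) ⟩
    sum (map (edgeColour p ∘ pos) (map vertex (around p)))
      ≡⟨ cong sum (sym (map-∘ {g = edgeColour p ∘ pos} {f = vertex} (around p))) ⟩
    sum (map (edgeColour p ∘ pos ∘ vertex) (around p))
      ≡⟨ cong sum (map-cong (cong (edgeColour p) ∘ pos-vertex) (around p)) ⟩
    sum (map (edgeColour p) (around p)) ∎)
    where
    open ≡-Reasoning
    p = pos i

  -- K = m + 4 computes to 6 + a.
  K : ℕ
  K = suc (suc Δ)

  inRange-K : ∀ {v} → InRange 6 v → InRange K v
  inRange-K (1≤v , v≤6) = 1≤v , ≤-trans v≤6 (m≤m+n 6 a)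

  inRange-5⇒6 : ∀ {v} → InRange 5 v → InRange 6 v
  inRange-5⇒6 (1≤v , v≤5) = 1≤v , m≤n⇒m≤1+n v≤5

  small≢big : ∀ {v} (j : Fin (suc a)) → v ≤ 5 → v ≢ 6 + toℕ j
  small≢big j v≤5 refl = n≮n 5 (≤-trans (m≤m+n 6 (toℕ j)) v≤5)

  bigSpoke≤bigSpokes : ∀ j → 6 + toℕ j ≤ bigSpokes
  bigSpoke≤bigSpokes = tabulate-≤-sum {n = suc a} (λ j → 6 + toℕ j)

  spokeColour-inRange : ∀ l y → InRange K (spokeColour l y)
  spokeColour-inRange zero    y = inRange-K (inRange-5⇒6 (firstSpoke-inRange (window y)))
  spokeColour-inRange (suc j) _ = s≤s z≤n , +-monoʳ-≤ 6 (toℕ≤pred[n] j)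

  spokeColour-injective : ∀ {l l′} y → spokeColour l y ≡ spokeColour l′ y → l ≡ l′
  spokeColour-injective {zero}  {zero}   _ _  = refl
  spokeColour-injective {zero}  {suc j}  y eq =
    ⊥-elim (small≢big j (proj₂ (firstSpoke-inRange (window y))) eq)
  spokeColour-injective {suc j} {zero}   y eq =
    ⊥-elim (small≢big j (proj₂ (firstSpoke-inRange (window y))) (sym eq))
  spokeColour-injective {suc j} {suc j′} _ eq = cong suc (toℕ-injective (+-cancelˡ-≡ 6 (toℕ j) (toℕ j′) eq))

  edgeTable≢spokeColour : ∀ L l y → (l ≡ zero → L ≢ leaf) → (∀ {j} → l ≡ suc j → L ≢ firstLeaf) →
    edgeTable L (phase y) ≢ spokeColour l y × edgeTable L (phase y) ≢ spokeColour l (next y)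
  edgeTable≢spokeColour L zero    y L≢ _  = edgeTable≢firstSpoke L (L≢ refl) (window y)
  edgeTable≢spokeColour L (suc j) y _  L≢ = small , small
    where
    small = small≢big j (edgeTable-small L (L≢ refl) (window y))

  hubEdge≢spokeColour : ∀ l y → edgeTable hub (phase y) ≢ spokeColour l y
                               × edgeTable hub (phase y) ≢ spokeColour l (next y)
  hubEdge≢spokeColour l y = edgeTable≢spokeColour hub l y (λ _ ()) (λ _ ())

  leafEdge≢spokeColour : ∀ l y → edgeTable (layerOf (suc l)) (phase y) ≢ spokeColour l y
                                × edgeTable (layerOf (suc l)) (phase y) ≢ spokeColour l (next y)
  leafEdge≢spokeColour l y = edgeTable≢spokeColour (layerOf (suc l)) l y (λ { refl () }) (λ { refl () })

  leafLayer≢hub : ∀ l → layerOf (suc l) ≢ hub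
  leafLayer≢hub zero    ()
  leafLayer≢hub (suc _) ()

  vertexColour-inRange : ∀ p → InRange K (vertexColour p)
  vertexColour-inRange (x , y) = inRange-K (inRange-5⇒6 (vertexTable-inRange (layerOf x) (window y)))

  colourOf-inRange : ∀ {p q} (e : Adjacent p q) → InRange K (colourOf e)
  colourOf-inRange (cycle-next {x} {y})         = inRange-K (edgeTable-inRange (layerOf x) (window y))
  colourOf-inRange (cycle-prev {x} {y′ = y′} _) = inRange-K (edgeTable-inRange (layerOf x) (window y′))
  colourOf-inRange (hub-leaf {y} l)             = spokeColour-inRange l y
  colourOf-inRange (leaf-hub {y} l)             = spokeColour-inRange l y

  vertexColour-proper : ∀ {p q} → Adjacent p q → vertexColour p ≢ vertexColour q
  vertexColour-proper (cycle-next {x} {y})            = vertexTable-proper (layerOf x) (window y)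
  vertexColour-proper (cycle-prev {x} {y′ = y′} refl) = ≢-sym (vertexTable-proper (layerOf x) (window y′))
  vertexColour-proper (hub-leaf {y} l) = hub≢vertexTable (layerOf (suc l)) (leafLayer≢hub l) (window y)
  vertexColour-proper (leaf-hub {y} l) = ≢-sym (hub≢vertexTable (layerOf (suc l)) (leafLayer≢hub l) (window y))

  colourOf≢vertexColour : ∀ {p q} (e : Adjacent p q) → colourOf e ≢ vertexColour p
  colourOf≢vertexColour (cycle-next {x} {y})            = proj₁ (edgeTable≢vertexTable (layerOf x) (window y))
  colourOf≢vertexColour (cycle-prev {x} {y′ = y′} refl) = proj₂ (edgeTable≢vertexTable (layerOf x) (window y′))
  colourOf≢vertexColour (hub-leaf {y} zero)    = firstSpoke≢vertexTable hub (λ ()) (window y)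
  colourOf≢vertexColour (hub-leaf {y} (suc j)) = small≢big j (proj₂ (vertexTable-inRange hub (window y))) ∘ sym
  colourOf≢vertexColour (leaf-hub {y} zero)    = firstSpoke≢vertexTable firstLeaf (λ ()) (window y)
  colourOf≢vertexColour (leaf-hub {y} (suc j)) = small≢big j (proj₂ (vertexTable-inRange leaf (window y))) ∘ sym

  colours-distinct : ∀ {p q r} (e₁ : Adjacent p q) (e₂ : Adjacent p r) → q ≢ r → colourOf e₁ ≢ colourOf e₂
  colours-distinct cycle-next cycle-next q≢r = contradiction refl q≢r
  colours-distinct (cycle-next {x}) (cycle-prev {y′ = y′} refl) _ =
    ≢-sym (edgeTable-proper (layerOf x) (window y′))
  colours-distinct (cycle-next {y = y}) (hub-leaf l) _ = proj₁ (hubEdge≢spokeColour l y)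
  colours-distinct (cycle-next {y = y}) (leaf-hub l) _ = proj₁ (leafEdge≢spokeColour l y)
  colours-distinct (cycle-prev {x} {y′ = y′} refl) cycle-next _ = edgeTable-proper (layerOf x) (window y′)
  colours-distinct (cycle-prev p≡) (cycle-prev p≡′) q≢r =
    contradiction (cong (_ ,_) (next-injective (trans (sym p≡) p≡′))) q≢r
  colours-distinct (cycle-prev {y′ = y′} refl) (hub-leaf l) _ = proj₂ (hubEdge≢spokeColour l y′)
  colours-distinct (cycle-prev {y′ = y′} refl) (leaf-hub l) _ = proj₂ (leafEdge≢spokeColour l y′)
  colours-distinct (hub-leaf {y} l) cycle-next _ = ≢-sym (proj₁ (hubEdge≢spokeColour l y))
  colours-distinct (hub-leaf l) (cycle-prev {y′ = y′} refl) _ = ≢-sym (proj₂ (hubEdge≢spokeColour l y′))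
  colours-distinct (hub-leaf {y} l) (hub-leaf l′) q≢r eq =
    q≢r (cong (λ l → suc l , y) (spokeColour-injective y eq))
  colours-distinct (leaf-hub {y} l) cycle-next _ = ≢-sym (proj₁ (leafEdge≢spokeColour l y))
  colours-distinct (leaf-hub l) (cycle-prev {y′ = y′} refl) _ = ≢-sym (proj₂ (leafEdge≢spokeColour l y′))
  colours-distinct (leaf-hub l) (leaf-hub l) q≢r = contradiction refl q≢r

  localWeight-next : ∀ x y →
    localWeight (x , next y) ≡ phaseWeight (layerOf x) (phase y) (phase (next y)) + fixedWeight x
  localWeight-next x y = trans (localWeight-split x (next y))
    (cong (λ z → phaseWeight (layerOf x) (phase z) (phase (next y)) + fixedWeight x) (prev-next y))

  localWeight-along-cycle : ∀ x y → localWeight (x , y) ≢ localWeight (x , next y)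
  localWeight-along-cycle x y eq = phaseWeight-proper (layerOf x) (window y)
    (+-cancelʳ-≡ (fixedWeight x) _ _ (trans (sym (localWeight-split x y)) (trans eq (localWeight-next x y))))

  leaf-weight<hub-weight : ∀ l y → localWeight (suc l , y) < localWeight (zero , y)
  leaf-weight<hub-weight l y rewrite localWeight-split (suc l) y | localWeight-split zero y = lighter l
    where
    W : ℕ
    W = phaseWeight hub (phase (prev y)) (phase y)
    lighter : ∀ l →
      phaseWeight (layerOf (suc l)) (phase (prev y)) (phase y) + fixedWeight (suc l) < W + bigSpokes
    lighter zero    = subst (_< W + bigSpokes) (sym (+-identityʳ _))
      (<-≤-trans (phaseWeight-firstLeaf<hub+6 (window y)) (+-monoʳ-≤ W (bigSpoke≤bigSpokes zero)))
    lighter (suc j) = +-mono-<-≤ (phaseWeight-leaf<hub (window y)) (bigSpoke≤bigSpokes j)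

  localWeight-proper : ∀ {p q} → Adjacent p q → localWeight p ≢ localWeight q
  localWeight-proper (cycle-next {x} {y})            = localWeight-along-cycle x y
  localWeight-proper (cycle-prev {x} {y′ = y′} refl) = ≢-sym (localWeight-along-cycle x y′)
  localWeight-proper (hub-leaf {y} l)                = ≢-sym (<⇒≢ (leaf-weight<hub-weight l y))
  localWeight-proper (leaf-hub {y} l)                = <⇒≢ (leaf-weight<hub-weight l y)

  colouring-nsd : IsNSDTotalColouring G K colouring
  colouring-nsd =
      (λ i → vertexColour-inRange (pos i))
    , (λ i j ij → let e = adj⇒Adjacent i j ij in
         subst (InRange K) (sym (edgeColour-Adjacent e)) (colourOf-inRange e))
    , (λ i j ij → let e = adj⇒Adjacent i j ij in
         trans (edgeColour-Adjacent e)
               (trans (sym (colourOf-sym e)) (sym (edgeColour-Adjacent (Adjacent-sym e)))))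
    , (λ i j ij → vertexColour-proper (adj⇒Adjacent i j ij))
    , (λ i j j′ ij ij′ j≢j′ eq → let e = adj⇒Adjacent i j ij; e′ = adj⇒Adjacent i j′ ij′ in
         colours-distinct e e′ (j≢j′ ∘ pos-injective)
           (trans (sym (edgeColour-Adjacent e)) (trans eq (edgeColour-Adjacent e′))))
    , (λ i j ij eq → let e = adj⇒Adjacent i j ij in
         colourOf≢vertexColour e (trans (sym (edgeColour-Adjacent e)) eq))
    , (λ i j ij eq → localWeight-proper (adj⇒Adjacent i j ij)
         (trans (sym (weight-colouring i)) (trans eq (weight-colouring j))))

  chromatic-number : TotalSumChromaticNumberIs G (suc (suc Δ))
  chromatic-number = (colouring , colouring-nsd) , colours-lower-bound

corollary4p7 : (m n : ℕ) → 2 ≤ m → 3 ≤ n →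
    TotalSumChromaticNumberIs (Star m □ Cycle n) (maxDegree (Star m □ Cycle n) + 2)
corollary4p7 (suc (suc a)) (suc (suc (suc k))) (s≤s (s≤s z≤n)) (s≤s (s≤s (s≤s z≤n))) =
  subst (TotalSumChromaticNumberIs G) Δ+2≡maxDegree+2 chromatic-number
  where
  open StarCycle a k
  Δ+2≡maxDegree+2 : suc (suc Δ) ≡ maxDegree G + 2
  Δ+2≡maxDegree+2 = trans (cong (λ d → suc (suc d)) (sym maxDegree≡Δ)) (+-comm 2 (maxDegree G))
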